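{- Let $L_A=(A,\mathsf{Act}_\tau,\to_A)$ and $L_B=(B,\mathsf{Act}_\tau,\to_B)$ be LTSs in $\mathrm{Fwd}$. For every $p\in A$ and $q\in B$, $p\preccurlyeq_{\mathsf{acc}}q$ if and only if $p\preccurlyeq^{\mathsf{fw}}_{\mathsf{acc}}q$.
   Context: Actions. Fix a countable set $\mathcal N$ of names (inputs), co-names $\overline{\mathcal N}=\{\bar a:a\in\mathcal N\}$ (outputs), and $\tau$; $\mathsf{Act}=\mathcal N\cup\overline{\mathcal N}$ (ranged over by $\mu$), $\mathsf{Act}_\tau=\mathsf{Act}\cup\{\tau\}$ (ranged over by $\alpha$), $\bar{\bar a}=a$. An LTS is $(A,\mathsf{Act}_\tau,\to)$ with decidable transitions; $p$ stable if not $p\xrightarrow{\tau}$; $O(p)=\{\bar a: p\xrightarrow{\bar a}\}$ (assumed finite), $I(p)=\{a\in\mathcal N: p\xrightarrow{a}\}$, $R(p)=I(p)\cup O(p)$. $\mathrm{Fwd}$: LTSs satisfying, for all states and $a\in\mathcal N$: (Output-commutativity) $p\xrightarrow{\bar a}p'\xrightarrow{\alpha}q$ implies $p\xrightarrow{\alpha}p''\xrightarrow{\bar a}q$ for some $p''$; (Output-determinacy) $p\xrightarrow{\bar a}p'$, $p\xrightarrow{\bar a}p''$ imply $p'=p''$; (Output-tau) $p\xrightarrow{\bar a}p'$, $p\xrightarrow{\tau}p''$ imply either some $q$ has $p'\xrightarrow{\tau}q$ and $p''\xrightarrow{\bar a}q$, or $p'\xrightarrow{a}p''$; (Output-confluence)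 $p\xrightarrow{\bar a}p'$, $p\xrightarrow{\alpha}p''$, $\alpha\notin\{\bar a,\tau\}$ imply some $q$ has $p'\xrightarrow{\alpha}q$ and $p''\xrightarrow{\bar a}q$; (Backward-output-determinacy) $p'\xrightarrow{\bar a}p$ and $p''\xrightarrow{\bar a}p$ imply $p'=p''$; (Boomerang) for every $p$ and $a$ there is $p'$ with $p\xrightarrow{a}p'\xrightarrow{\bar a}p$; (Fwd-Feedback) $p\xrightarrow{\bar a}p'\xrightarrow{a}q$ implies $p\xrightarrow{\tau}q$ or $p=q$. Weak transitions, convergence. $p\overset{s}{\Longrightarrow}p'$ ($s\in\mathsf{Act}^*$): least relation with $p\overset{\varepsilon}{\Longrightarrow}p$; $p\xrightarrow{\tau}p''\overset{s}{\Longrightarrow}p'\Rightarrow p\overset{s}{\Longrightarrow}p'$; $p\xrightarrow{\mu}p''\overset{s}{\Longrightarrow}p'\Rightarrow p\overset{\mu s}{\Longrightarrow}p'$. $p\downarrow$: every $\tau$-sequence from $p$ is finite. $p\Downarrow\varepsilon$ iff $p\downarrow$; $p\Downarrow\mu s$ iff $p\downarrow$ and $p'\Downarrow s$ whenever $p\overset{\mu}{\Longrightarrow}p'$. Acceptance sets. $\mathcal A(p,s)=\{R(p'): p\overset{s}{\Longrightarrow}p',\ p'\text{ stable}\}$ and $\mathcal A^{\mathsf{fw}}(p,s)=\{O(p'): p\overset{s}{\Longrightarrow}p',\ p'\text{ stable}\}$. For families $\mathcal X,\mathcal Y$ of sets, $\mathcal X\ll\mathcal Y$ iff for every $Y\in\mathcal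 Y$ there is $X\in\mathcal X$ with $X\subseteq Y$. $p\preccurlyeq_{\mathsf{acc}}q$ iff for all $s\in\mathsf{Act}^*$, $p\Downarrow s$ implies $\mathcal A(p,s)\ll\mathcal A(q,s)$; $p\preccurlyeq^{\mathsf{fw}}_{\mathsf{acc}}q$ iff for all $s\in\mathsf{Act}^*$, $p\Downarrow s$ implies $\mathcal A^{\mathsf{fw}}(p,s)\ll\mathcal A^{\mathsf{fw}}(q,s)$ (each computed in the LTS of its argument). -}

module Defs where

open import Level using (Level; 0ℓ) renaming (suc to lsuc)
open import Data.Product using (Σ; ∃; _×_; _,_)
open import Data.Sum using (_⊎_)
open import Data.List using (List; []; _∷_)
open import Data.List.Membership.Propositional using (_∈_)
open import Relation.Nullary using (¬_; Dec)
open import Relation.Binary.PropositionalEquality using (_≡_)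

module Theory (Name : Set) where

  data Act : Set where
    inp : Name → Act
    out : Name → Act

  data ActT : Set where
    τ   : ActT
    vis : Act → ActT

  record LTS (S : Set) : Set₁ where
    field
      _⟶[_]_   : S → ActT → S → Set
      trans-dec : ∀ p α q → Dec (p ⟶[ α ] q)
      out-finite : ∀ p → Σ (List Name) λ xs → ∀ a p' → p ⟶[ vis (out a) ] p' → a ∈ xs

  module _ {S : Set} (L : LTS S) where
    open LTS L

    record IsFwd : Set where
      field
        output-commutativity : ∀ {p p' q a α} → p ⟶[ vis (out a) ] p' → p' ⟶[ α ] q →
                               ∃ λ p'' → p ⟶[ α ] p'' × p'' ⟶[ vis (out a) ] q
        output-determinacy   : ∀ {p p' p'' a} → p ⟶[ vis (out a) ] p' → p ⟶[ vis (out a) ] p'' → p' ≡ p''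
        output-tau           : ∀ {p p' p'' a} → p ⟶[ vis (out a) ] p' → p ⟶[ τ ] p'' →
                               (∃ λ q → p' ⟶[ τ ] q × p'' ⟶[ vis (out a) ] q) ⊎ p' ⟶[ vis (inp a) ] p''
        output-confluence    : ∀ {p p' p'' a α} → p ⟶[ vis (out a) ] p' → p ⟶[ α ] p'' →
                               ¬ (α ≡ vis (out a)) → ¬ (α ≡ τ) →
                               ∃ λ q → p' ⟶[ α ] q × p'' ⟶[ vis (out a) ] q
        backward-output-determinacy : ∀ {p p' p'' a} → p' ⟶[ vis (out a) ] p → p'' ⟶[ vis (out a) ] p → p' ≡ p''
        boomerang            : ∀ p a → ∃ λ p' → p ⟶[ vis (inp a) ] p' × p' ⟶[ vis (out a) ] p
        fwd-feedback         : ∀ {p p' q a} → p ⟶[ vis (out a) ] p' → p' ⟶[ vis (inp a) ] q →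
                               p ⟶[ τ ] q ⊎ p ≡ q

    stable : S → Set
    stable p = ∀ p' → ¬ (p ⟶[ τ ] p')

    O : S → Act → Set
    O p (inp a) = Data.Empty.⊥ where import Data.Empty
    O p (out a) = ∃ λ p' → p ⟶[ vis (out a) ] p'

    R : S → Act → Set
    R p μ = ∃ λ p' → p ⟶[ vis μ ] p'

    data _⟹[_]_ : S → List Act → S → Set where
      wt-refl : ∀ {p} → p ⟹[ [] ] p
      wt-tau  : ∀ {p p'' p' s} → p ⟶[ τ ] p'' → p'' ⟹[ s ] p' → p ⟹[ s ] p'
      wt-act  : ∀ {p p'' p' μ s} → p ⟶[ vis μ ] p'' → p'' ⟹[ s ] p' → p ⟹[ μ ∷ s ] p'

    -- p↓ : every τ-sequence from p is finite (inductive / well-founded reading)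
    data _↓ : S → Set where
      conv : ∀ {p} → (∀ p' → p ⟶[ τ ] p' → p' ↓) → p ↓

    _⇓_ : S → List Act → Set
    p ⇓ [] = p ↓
    p ⇓ (μ ∷ s) = p ↓ × (∀ p' → p ⟹[ μ ∷ [] ] p' → p' ⇓ s)

  ASet : Set₁
  ASet = Act → Set

  _⊆_ : ASet → ASet → Set
  X ⊆ Y = ∀ μ → X μ → Y μ

  _≐_ : ASet → ASet → Set
  X ≐ Y = X ⊆ Y × Y ⊆ X

  _≪_ : (ASet → Set₁) → (ASet → Set₁) → Set₁
  𝒳 ≪ 𝒴 = ∀ Y → 𝒴 Y → Σ ASet λ X → 𝒳 X × X ⊆ Y

  module _ {S : Set} (L : LTS S) where
    open LTS L

    -- 𝒜(p,s) = { R(p') : p =s=> p', p' stable }  (membership up to extensional equality of sets)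
    𝒜 : S → List Act → ASet → Set₁
    𝒜 p s X = Σ S λ p' → Level.Lift (lsuc 0ℓ) (_⟹[_]_ L p s p' × stable L p' × X ≐ R L p')

    𝒜fw : S → List Act → ASet → Set₁
    𝒜fw p s X = Σ S λ p' → Level.Lift (lsuc 0ℓ) (_⟹[_]_ L p s p' × stable L p' × X ≐ O L p')

  ≼acc : ∀ {A B : Set} (LA : LTS A) (LB : LTS B) → A → B → Set₁
  ≼acc LA LB p q = ∀ s → _⇓_ LA p s → 𝒜 LA p s ≪ 𝒜 LB q s

  ≼accfw : ∀ {A B : Set} (LA : LTS A) (LB : LTS B) → A → B → Set₁
  ≼accfw LA LB p q = ∀ s → _⇓_ LA p s → 𝒜fw LA p s ≪ 𝒜fw LB q s

-- In Fwd every state can perform every input (boomerang), so R(p) = 𝒩 ∪ O(p) for all p.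
-- Hence R(p') ⊆ R(q') iff O(p') ⊆ O(q'), and since 𝒜(p,s) and 𝒜fw(p,s) are indexed by the
-- same stable s-derivatives, the two acceptance preorders coincide.
module Submission where

open import Defs
open import Data.Nat using (ℕ)
open import Data.Product using (_,_)
open import Function.Bundles using (_↣_; _⇔_; mk⇔)
open import Level using (lift)

module _ {Name : Set} where
  open Theory Name

  ≐-refl : ∀ {X : ASet} → X ≐ X
  ≐-refl = (λ _ x → x) , (λ _ x → x)

  module _ {S : Set} (L : LTS S) where

    inp∈R : IsFwd L → ∀ p a → R L p (inp a)
    inp∈R fwd p a with IsFwd.boomerang fwd p a
    ... | p' , p-a→p' , _ = p' , p-a→p'

    R∈𝒜 : ∀ {p s p'} → _⟹[_]_ L p s p' → stable L p' → 𝒜 L p s (R L p')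
    R∈𝒜 {p' = p'} w st = p' , lift (w , st , ≐-refl)

    O∈𝒜fw : ∀ {p s p'} → _⟹[_]_ L p s p' → stable L p' → 𝒜fw L p s (O L p')
    O∈𝒜fw {p' = p'} w st = p' , lift (w , st , ≐-refl)

  module _ {A B : Set} (LA : LTS A) (LB : LTS B) where

    R⊆R⇒O⊆O : ∀ {p q} → R LA p ⊆ R LB q → O LA p ⊆ O LB q
    R⊆R⇒O⊆O R⊆R (out a) o = R⊆R (out a) o

    O⊆O⇒R⊆R : IsFwd LB → ∀ {p q} → O LA p ⊆ O LB q → R LA p ⊆ R LB q
    O⊆O⇒R⊆R fwd {q = q} O⊆O (inp a) _ = inp∈R LB fwd q a
    O⊆O⇒R⊆R fwd         O⊆O (out a) o = O⊆O (out a) o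

    𝒜≪⇒𝒜fw≪ : ∀ {p q s} → 𝒜 LA p s ≪ 𝒜 LB q s → 𝒜fw LA p s ≪ 𝒜fw LB q s
    𝒜≪⇒𝒜fw≪ 𝒜≪ Y (q' , lift (wq , stq , _ , O⊆Y))
      with 𝒜≪ (R LB q') (R∈𝒜 LB wq stq)
    ... | X , (p' , lift (wp , stp , _ , R⊆X)) , X⊆R =
      O LA p' , O∈𝒜fw LA wp stp ,
      λ μ o → O⊆Y μ (R⊆R⇒O⊆O (λ ν r → X⊆R ν (R⊆X ν r)) μ o)

    𝒜fw≪⇒𝒜≪ : IsFwd LB → ∀ {p q s} → 𝒜fw LA p s ≪ 𝒜fw LB q s → 𝒜 LA p s ≪ 𝒜 LB q s
    𝒜fw≪⇒𝒜≪ fwd 𝒜fw≪ Y (q' , lift (wq , stq , _ , R⊆Y))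
      with 𝒜fw≪ (O LB q') (O∈𝒜fw LB wq stq)
    ... | X , (p' , lift (wp , stp , _ , O⊆X)) , X⊆O =
      R LA p' , R∈𝒜 LA wp stp ,
      λ μ r → R⊆Y μ (O⊆O⇒R⊆R fwd (λ ν o → X⊆O ν (O⊆X ν o)) μ r)

lemma4 : (Name : Set) → Name ↣ ℕ →
    let open Theory Name in
    ∀ {A B : Set} (LA : LTS A) (LB : LTS B) → IsFwd LA → IsFwd LB →
    ∀ (p : A) (q : B) → ≼acc LA LB p q ⇔ ≼accfw LA LB p q
lemma4 Name _ LA LB _ fwdB p q =
  mk⇔ (λ acc s p⇓s → 𝒜≪⇒𝒜fw≪ LA LB (acc s p⇓s))
      (λ accfw s p⇓s → 𝒜fw≪⇒𝒜≪ LA LB fwdB (accfw s p⇓s))
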